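{- Let $k\ge1$. For integers $i\ge 0$ and $h$, let $C_i^{[h]}$ be the characteristic series of the set of labelled paths with steps $a_1,\dots,a_k,b,c$ that start and end at level $i$ and never go below level $i$ nor above level $i+h$ (with $C_i^{[h]}=0$ for $h<0$). For $1\le\ell\le k$ put $$\langle C_i^{[h]}\rangle_\ell = a_{i,\ell}\,C^{[h-\ell]}_{i+\ell}\,b_{i+\ell}\,C^{[h-\ell+1]}_{i+\ell-1}\,b_{i+\ell-1}\cdots C^{[h-1]}_{i+1}\,b_{i+1}.$$ Then for all $i,h\ge 0$, $$C_i^{[h]}=\Big(1-c_i-\sum_{\ell=1}^k\langle C_i^{[h]}\rangle_\ell\Big)^{ -1}.$$ Moreover, for each $i\ge 0$ the sequence $(C_i^{[h]})_{h\ge0}$ converges as $h\to\infty$ to the characteristic series $C_i$ of all labelled paths starting and ending at level $i$ and never going below level $i$, and these limits satisfy $$C_i=\Big(1-c_i-\sum_{\ell=1}^k\langle C_i\rangle_\ell\Big)^{ -1},\qquad \langle C_i\rangle_\ell=a_{i,\ell}\,C_{i+\ell}\,b_{i+\ell}\,C_{i+\ell-1}\,b_{i+\ell-1}\cdots C_{i+1}\,b_{i+1}.$$ In particular $C_0$ is the characteristic series of all labelled paths starting and ending on the $x$-axis and never going below it.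
   Context: Alphabet $X=\{b_j, c_j, a_{j,\ell}: j\ge 0, 1\le \ell\le k\}$ of non-commuting variables. $\mathbb{C}\langle\langle X\rangle\rangle$ denotes the algebra of formal power series $\sum_{u\in X^*}s_u u$ in non-commuting variables with the usual sum and Cauchy product; the valuation $\mathrm{val}(s)$ is the minimal length of a word with nonzero coefficient, and $s_n\to s$ means $\mathrm{val}(s-s_n)\to\infty$. For a series $w$ with zero constant term, $(1-w)^{ -1}=\sum_{m\ge0}w^m$. The characteristic series of a set $S\subseteq X^*$ is $\sum_{u\in S}u$. Step vectors: $a_\ell=(1,\ell)$ ($1\le\ell\le k$), $b=(1,-1)$, $c=(1,0)$. A path is a word over these steps; starting at a point of height $y_0$, its points are $M_j=M_{j-1}+u_j$ with heights $y_j$. Its labelling is the word $v_1\cdots v_n\in X^*$ with $v_j=a_{y_{j-1},\ell}$, $b_{y_{j-1}}$ or $c_{y_{j-1}}$ according as $u_j=a_\ell$, $b$ or $c$ (each step is indexed by the absolute height of its starting point). -}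

module Defs where

open import Data.Nat using (ℕ; zero; suc; _+_; _*_; _∸_; _≤_; _<_; _≤ᵇ_)
open import Data.Nat.Properties using () renaming (_≟_ to _≟ℕ_)
open import Data.Fin using (Fin; toℕ) renaming (_≟_ to _≟F_)
open import Data.List using (List; []; _∷_; [_]; map; length; upTo; allFin)
open import Data.Nat.ListAction using (sum)
open import Data.List.Properties using (≡-dec)
open import Data.Product using (Σ; _×_; _,_; ∃)
open import Data.Maybe using (Maybe; just; nothing)
open import Data.Unit using (⊤)
open import Data.Bool using (if_then_else_)
open import Relation.Nullary using (¬_; yes; no)
open import Relation.Binary.PropositionalEquality using (_≡_; refl; cong; cong₂)
open import Relation.Binary.Definitions using (DecidableEquality)

-- The alphabet X = { b_j , c_j , a_{j,ℓ} : j ≥ 0, 1 ≤ ℓ ≤ k }.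
-- The index ℓ ∈ {1..k} is represented by ℓf : Fin k with ℓ = suc (toℕ ℓf).

data Letter (k : ℕ) : Set where
  a : ℕ → Fin k → Letter k
  b : ℕ → Letter k
  c : ℕ → Letter k

_≟L_ : {k : ℕ} → DecidableEquality (Letter k)
a i ℓ ≟L a j m with i ≟ℕ j | ℓ ≟F m
... | yes refl | yes refl = yes refl
... | no ¬p    | _        = no λ { refl → ¬p refl }
... | yes _    | no ¬q    = no λ { refl → ¬q refl }
a _ _ ≟L b _ = no λ ()
a _ _ ≟L c _ = no λ ()
b _ ≟L a _ _ = no λ ()
b i ≟L b j with i ≟ℕ j
... | yes refl = yes refl
... | no ¬p    = no λ { refl → ¬p refl }
b _ ≟L c _ = no λ ()
c _ ≟L a _ _ = no λ ()
c _ ≟L b _ = no λ ()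
c i ≟L c j with i ≟ℕ j
... | yes refl = yes refl
... | no ¬p    = no λ { refl → ¬p refl }

Word : ℕ → Set
Word k = List (Letter k)

Series : ℕ → Set
Series k = Word k → ℕ

_≈_ : {k : ℕ} → Series k → Series k → Set
s ≈ t = ∀ u → s u ≡ t u

𝟘 : {k : ℕ} → Series k
𝟘 _ = 0

𝟙 : {k : ℕ} → Series k
𝟙 []      = 1
𝟙 (_ ∷ _) = 0

sing : {k : ℕ} → Letter k → Series k
sing x u with ≡-dec _≟L_ u [ x ]
... | yes _ = 1
... | no _  = 0

_⊕_ : {k : ℕ} → Series k → Series k → Series k
(s ⊕ t) u = s u + t u

splits : {k : ℕ} → Word k → List (Word k × Word k)
splits []      = ([] , []) ∷ []
splits (x ∷ u) = ([] , x ∷ u) ∷ map (λ { (v , w) → (x ∷ v , w) }) (splits u)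

_⊗_ : {k : ℕ} → Series k → Series k → Series k
(s ⊗ t) u = sum (map (λ { (v , w) → s v * t w }) (splits u))

infixl 6 _⊕_
infixl 7 _⊗_

Σℓ : {k : ℕ} → (Fin k → Series k) → Series k
Σℓ {k} f u = sum (map (λ ℓ → f ℓ u) (allFin k))

_^_ : {k : ℕ} → Series k → ℕ → Series k
w ^ zero  = 𝟙
w ^ suc m = w ⊗ (w ^ m)

-- (1 - w)^{-1} = Σ_{m ≥ 0} w^m, for w with zero constant term.
-- When w [] ≡ 0, w^m has valuation ≥ m, so the coefficient of u in the
-- infinite sum is the finite sum over m ≤ length u.
inv1- : {k : ℕ} → Series k → Series k
inv1- w u = sum (map (λ m → (w ^ m) u) (upTo (suc (length u))))

-- s_n → s : val(s - s_n) → ∞, i.e. for every N, eventually all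
-- coefficients of words of length < N agree.
Converges : {k : ℕ} → (ℕ → Series k) → Series k → Set
Converges sn s = ∀ N → ∃ λ H → ∀ n → H ≤ n → ∀ u → length u < N → sn n u ≡ s u

IsCharSeries : {k : ℕ} → (Word k → Set) → Series k → Set
IsCharSeries S s = ∀ u → (S u → s u ≡ 1) × (¬ S u → s u ≡ 0)

-- Paths with steps a_ℓ = (1,ℓ), b = (1,-1), c = (1,0) and their labellings.

data Step (k : ℕ) : Set where
  up   : Fin k → Step k     -- a_ℓ, ℓ = suc (toℕ ℓf)
  down : Step k
  flat : Step k

-- labelling of a path starting at height y (each step indexed by the
-- height of its starting point)
label : {k : ℕ} → ℕ → List (Step k) → Word k
label y []            = []
label y (up ℓ ∷ p)    = a y ℓ ∷ label (y + suc (toℕ ℓ)) p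
label y (down ∷ p)    = b y ∷ label (y ∸ 1) p
label y (flat ∷ p)    = c y ∷ label y p

-- upper bound: nothing = no upper bound, just h = level i + h
BelowTop : Maybe ℕ → ℕ → ℕ → Set
BelowTop nothing  i z = ⊤
BelowTop (just h) i z = z ≤ i + h

Stays : {k : ℕ} → ℕ → Maybe ℕ → ℕ → List (Step k) → Set
Stays i B y []          = y ≡ i
Stays i B y (up ℓ ∷ p)  = BelowTop B i (y + suc (toℕ ℓ)) × Stays i B (y + suc (toℕ ℓ)) p
Stays i B y (down ∷ p)  = i < y × Stays i B (y ∸ 1) p
Stays i B y (flat ∷ p)  = Stays i B y p

PathSet : (k : ℕ) → ℕ → Maybe ℕ → Word k → Set
PathSet k i B u = Σ (List (Step k)) λ p → label i p ≡ u × Stays i B i p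

-- ⟨ · ⟩_ℓ : given G m (the series attached to level i+m),
-- ⟨⟩ = a_{i,ℓ} G ℓ b_{i+ℓ} G (ℓ-1) b_{i+ℓ-1} ⋯ G 1 b_{i+1}

chain : {k : ℕ} → ℕ → (ℕ → Series k) → ℕ → Series k
chain i G zero    = 𝟙
chain i G (suc j) = G (suc j) ⊗ sing (b (i + suc j)) ⊗ chain i G j

bracket : {k : ℕ} → ℕ → (ℕ → Series k) → Fin k → Series k
bracket i G ℓ = sing (a i ℓ) ⊗ chain i G (suc (toℕ ℓ))

finG : {k : ℕ} → (ℕ → ℕ → Series k) → ℕ → ℕ → ℕ → Series k
finG C i h m = if m ≤ᵇ h then C (i + m) (h ∸ m) else 𝟘

rhs : {k : ℕ} → ℕ → (ℕ → Series k) → Series k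
rhs i G = inv1- (sing (c i) ⊕ Σℓ (bracket i G))

module Submission where

-- Every series of the statement is identified with a computable series
-- `paths i T y`, whose 0/1 coefficient at a word u says whether u labels a
-- path from height y to height i staying in the band [i, T] (T an absolute
-- ceiling, or none); it reads u letter by letter like an automaton.

open import Defs
open import Data.Nat using (ℕ; _≤_; _+_)
open import Data.Maybe using (just; nothing)
open import Data.Product using (_×_)

open import Data.Nat using (zero; suc; _*_; _∸_; _<_; z≤n; s≤s; _≤ᵇ_)
import Data.Nat.Properties as ℕₚ
open import Data.Nat.Solver using (module +-*-Solver)
open import Data.Nat.ListAction using (sum)
open import Data.List using (List; []; _∷_; length; applyUpTo; tabulate)
import Data.List.Properties as Listₚ
open import Data.Fin using (Fin; toℕ) renaming (zero to fzero; suc to fsuc)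
open import Data.Fin.Properties using (toℕ<n; suc-injective)
open import Data.Maybe using (Maybe) renaming (map to maybe-map)
open import Data.Product using (Σ; _,_; proj₁; proj₂)
open import Data.Sum using (_⊎_; inj₁; inj₂)
open import Data.Unit using (⊤; tt)
open import Data.Bool using (true; false)
open import Data.Empty using (⊥-elim)
open import Function using (_∘_)
open import Relation.Nullary using (¬_; yes; no; Dec)
open import Relation.Nullary.Reflects using (ofʸ; ofⁿ)
open import Relation.Binary.PropositionalEquality using (_≡_; refl; cong; cong₂; sym; trans; module ≡-Reasoning)

module SeriesAlgebra {k : ℕ} where
  open +-*-Solver
  open ≡-Reasoning

  -- The left quotient of s by the letter x; a series is determined by its
  -- constant term and all its left quotients.
  ∂ : Letter k → Series k → Series k
  ∂ x s v = s (x ∷ v)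

  _·_ : ℕ → Series k → Series k
  (n · t) v = n * t v

  ⊗-[] : (s t : Series k) → (s ⊗ t) [] ≡ s [] * t []
  ⊗-[] s t = ℕₚ.+-identityʳ _

  ⊗-∷ : (s t : Series k) (x : Letter k) (u : Word k) →
        (s ⊗ t) (x ∷ u) ≡ s [] * t (x ∷ u) + (∂ x s ⊗ t) u
  ⊗-∷ s t x u = cong (s [] * t (x ∷ u) +_) (cong sum (sym (Listₚ.map-∘ (splits u))))

  ⊗-congˡ : (s s' t : Series k) → s ≈ s' → (s ⊗ t) ≈ (s' ⊗ t)
  ⊗-congˡ s s' t e [] = cong (_+ 0) (cong (_* t []) (e []))
  ⊗-congˡ s s' t e (x ∷ u) = begin
      (s ⊗ t) (x ∷ u)                        ≡⟨ ⊗-∷ s t x u ⟩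
      s [] * t (x ∷ u) + (∂ x s ⊗ t) u       ≡⟨ cong₂ _+_ (cong (_* t (x ∷ u)) (e []))
                                                   (⊗-congˡ (∂ x s) (∂ x s') t (e ∘ (x ∷_)) u) ⟩
      s' [] * t (x ∷ u) + (∂ x s' ⊗ t) u     ≡⟨ sym (⊗-∷ s' t x u) ⟩
      (s' ⊗ t) (x ∷ u)                       ∎

  ⊗-congʳ : (s t t' : Series k) (u : Word k) →
            (∀ v → length v ≤ length u → t v ≡ t' v) → (s ⊗ t) u ≡ (s ⊗ t') u
  ⊗-congʳ s t t' [] e = cong (_+ 0) (cong (s [] *_) (e [] z≤n))
  ⊗-congʳ s t t' (x ∷ u) e = begin
      (s ⊗ t) (x ∷ u)                        ≡⟨ ⊗-∷ s t x u ⟩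
      s [] * t (x ∷ u) + (∂ x s ⊗ t) u       ≡⟨ cong₂ _+_ (cong (s [] *_) (e (x ∷ u) ℕₚ.≤-refl))
                                                   (⊗-congʳ (∂ x s) t t' u (λ v l → e v (ℕₚ.m≤n⇒m≤1+n l))) ⟩
      s [] * t' (x ∷ u) + (∂ x s ⊗ t') u     ≡⟨ sym (⊗-∷ s t' x u) ⟩
      (s ⊗ t') (x ∷ u)                       ∎

  𝟘⊗ : (t : Series k) → (𝟘 ⊗ t) ≈ 𝟘
  𝟘⊗ t [] = refl
  𝟘⊗ t (x ∷ u) = trans (⊗-∷ 𝟘 t x u) (𝟘⊗ t u)

  ⊗𝟘 : (s : Series k) → (s ⊗ 𝟘) ≈ 𝟘
  ⊗𝟘 s [] = trans (⊗-[] s 𝟘) (ℕₚ.*-zeroʳ (s []))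
  ⊗𝟘 s (x ∷ u) = trans (⊗-∷ s 𝟘 x u) (cong₂ _+_ (ℕₚ.*-zeroʳ (s [])) (⊗𝟘 (∂ x s) u))

  𝟙⊗ : (t : Series k) → (𝟙 ⊗ t) ≈ t
  𝟙⊗ t [] = trans (⊗-[] 𝟙 t) (ℕₚ.*-identityˡ (t []))
  𝟙⊗ t (x ∷ u) = trans (⊗-∷ 𝟙 t x u)
                       (trans (cong₂ _+_ (ℕₚ.*-identityˡ (t (x ∷ u))) (𝟘⊗ t u)) (ℕₚ.+-identityʳ _))

  ⊕-⊗ : (s s' t : Series k) → ((s ⊕ s') ⊗ t) ≈ ((s ⊗ t) ⊕ (s' ⊗ t))
  ⊕-⊗ s s' t [] = trans (⊗-[] (s ⊕ s') t) (trans (ℕₚ.*-distribʳ-+ (t []) (s []) (s' []))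
                    (sym (cong₂ _+_ (⊗-[] s t) (⊗-[] s' t))))
  ⊕-⊗ s s' t (x ∷ u) = begin
      ((s ⊕ s') ⊗ t) (x ∷ u)
        ≡⟨ ⊗-∷ (s ⊕ s') t x u ⟩
      (s [] + s' []) * t (x ∷ u) + (∂ x (s ⊕ s') ⊗ t) u
        ≡⟨ cong ((s [] + s' []) * t (x ∷ u) +_) (⊕-⊗ (∂ x s) (∂ x s') t u) ⟩
      (s [] + s' []) * t (x ∷ u) + ((∂ x s ⊗ t) u + (∂ x s' ⊗ t) u)
        ≡⟨ rearrange (s []) (s' []) (t (x ∷ u)) ((∂ x s ⊗ t) u) ((∂ x s' ⊗ t) u) ⟩
      (s [] * t (x ∷ u) + (∂ x s ⊗ t) u) + (s' [] * t (x ∷ u) + (∂ x s' ⊗ t) u)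
        ≡⟨ sym (cong₂ _+_ (⊗-∷ s t x u) (⊗-∷ s' t x u)) ⟩
      (s ⊗ t) (x ∷ u) + (s' ⊗ t) (x ∷ u) ∎
    where
    rearrange : ∀ a b c d e → (a + b) * c + (d + e) ≡ (a * c + d) + (b * c + e)
    rearrange = solve 5 (λ a b c d e → (a :+ b) :* c :+ (d :+ e) := (a :* c :+ d) :+ (b :* c :+ e)) refl

  ⊗-⊕ : (s t t' : Series k) → (s ⊗ (t ⊕ t')) ≈ ((s ⊗ t) ⊕ (s ⊗ t'))
  ⊗-⊕ s t t' [] = trans (⊗-[] s (t ⊕ t')) (trans (ℕₚ.*-distribˡ-+ (s []) (t []) (t' []))
                    (sym (cong₂ _+_ (⊗-[] s t) (⊗-[] s t'))))
  ⊗-⊕ s t t' (x ∷ u) = begin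
      (s ⊗ (t ⊕ t')) (x ∷ u)
        ≡⟨ ⊗-∷ s (t ⊕ t') x u ⟩
      s [] * (t (x ∷ u) + t' (x ∷ u)) + (∂ x s ⊗ (t ⊕ t')) u
        ≡⟨ cong (s [] * (t (x ∷ u) + t' (x ∷ u)) +_) (⊗-⊕ (∂ x s) t t' u) ⟩
      s [] * (t (x ∷ u) + t' (x ∷ u)) + ((∂ x s ⊗ t) u + (∂ x s ⊗ t') u)
        ≡⟨ rearrange (s []) (t (x ∷ u)) (t' (x ∷ u)) ((∂ x s ⊗ t) u) ((∂ x s ⊗ t') u) ⟩
      (s [] * t (x ∷ u) + (∂ x s ⊗ t) u) + (s [] * t' (x ∷ u) + (∂ x s ⊗ t') u)
        ≡⟨ sym (cong₂ _+_ (⊗-∷ s t x u) (⊗-∷ s t' x u)) ⟩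
      (s ⊗ t) (x ∷ u) + (s ⊗ t') (x ∷ u) ∎
    where
    rearrange : ∀ a b c d e → a * (b + c) + (d + e) ≡ (a * b + d) + (a * c + e)
    rearrange = solve 5 (λ a b c d e → a :* (b :+ c) :+ (d :+ e) := (a :* b :+ d) :+ (a :* c :+ e)) refl

  ·-⊗ : (n : ℕ) (t r : Series k) → ((n · t) ⊗ r) ≈ (n · (t ⊗ r))
  ·-⊗ n t r [] = trans (⊗-[] (n · t) r) (trans (ℕₚ.*-assoc n (t []) (r [])) (cong (n *_) (sym (⊗-[] t r))))
  ·-⊗ n t r (x ∷ u) = begin
      ((n · t) ⊗ r) (x ∷ u)                          ≡⟨ ⊗-∷ (n · t) r x u ⟩
      n * t [] * r (x ∷ u) + ((n · ∂ x t) ⊗ r) u     ≡⟨ cong (n * t [] * r (x ∷ u) +_) (·-⊗ n (∂ x t) r u) ⟩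
      n * t [] * r (x ∷ u) + n * (∂ x t ⊗ r) u       ≡⟨ factor n (t []) (r (x ∷ u)) ((∂ x t ⊗ r) u) ⟩
      n * (t [] * r (x ∷ u) + (∂ x t ⊗ r) u)         ≡⟨ cong (n *_) (sym (⊗-∷ t r x u)) ⟩
      n * (t ⊗ r) (x ∷ u)                            ∎
    where
    factor : ∀ a b c d → a * b * c + a * d ≡ a * (b * c + d)
    factor = solve 4 (λ a b c d → a :* b :* c :+ a :* d := a :* (b :* c :+ d)) refl

  ⊗-assoc : (s t r : Series k) → ((s ⊗ t) ⊗ r) ≈ (s ⊗ (t ⊗ r))
  ⊗-assoc s t r [] = begin
      (s [] * t [] + 0) * r [] + 0  ≡⟨ cong (λ z → z * r [] + 0) (ℕₚ.+-identityʳ (s [] * t [])) ⟩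
      s [] * t [] * r [] + 0        ≡⟨ cong (_+ 0) (ℕₚ.*-assoc (s []) (t []) (r [])) ⟩
      s [] * (t [] * r []) + 0      ≡⟨ cong (λ z → s [] * z + 0) (sym (ℕₚ.+-identityʳ (t [] * r []))) ⟩
      s [] * (t [] * r [] + 0) + 0  ∎
  ⊗-assoc s t r (x ∷ u) = begin
      ((s ⊗ t) ⊗ r) (x ∷ u)
        ≡⟨ ⊗-∷ (s ⊗ t) r x u ⟩
      (s ⊗ t) [] * r (x ∷ u) + (∂ x (s ⊗ t) ⊗ r) u
        ≡⟨ cong₂ _+_ (cong (_* r (x ∷ u)) (⊗-[] s t))
                     (⊗-congˡ (∂ x (s ⊗ t)) ((s [] · ∂ x t) ⊕ (∂ x s ⊗ t)) r (⊗-∷ s t x) u) ⟩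
      s [] * t [] * r (x ∷ u) + (((s [] · ∂ x t) ⊕ (∂ x s ⊗ t)) ⊗ r) u
        ≡⟨ cong (s [] * t [] * r (x ∷ u) +_)
                (trans (⊕-⊗ (s [] · ∂ x t) (∂ x s ⊗ t) r u)
                       (cong₂ _+_ (·-⊗ (s []) (∂ x t) r u) (⊗-assoc (∂ x s) t r u))) ⟩
      s [] * t [] * r (x ∷ u) + (s [] * (∂ x t ⊗ r) u + (∂ x s ⊗ (t ⊗ r)) u)
        ≡⟨ factor (s []) (t []) (r (x ∷ u)) ((∂ x t ⊗ r) u) ((∂ x s ⊗ (t ⊗ r)) u) ⟩
      s [] * (t [] * r (x ∷ u) + (∂ x t ⊗ r) u) + (∂ x s ⊗ (t ⊗ r)) u
        ≡⟨ cong (λ z → s [] * z + (∂ x s ⊗ (t ⊗ r)) u) (sym (⊗-∷ t r x u)) ⟩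
      s [] * (t ⊗ r) (x ∷ u) + (∂ x s ⊗ (t ⊗ r)) u
        ≡⟨ sym (⊗-∷ s (t ⊗ r) x u) ⟩
      (s ⊗ (t ⊗ r)) (x ∷ u) ∎
    where
    factor : ∀ a b c d e → a * b * c + (a * d + e) ≡ a * (b * c + d) + e
    factor = solve 5 (λ a b c d e → a :* b :* c :+ (a :* d :+ e) := a :* (b :* c :+ d) :+ e) refl

  sing-same : (y : Letter k) (v : Word k) → sing y (y ∷ v) ≡ 𝟙 v
  sing-same y [] with Listₚ.≡-dec _≟L_ (y ∷ []) (y ∷ [])
  ... | yes _ = refl
  ... | no ¬p = ⊥-elim (¬p refl)
  sing-same y (w ∷ ws) with Listₚ.≡-dec _≟L_ (y ∷ w ∷ ws) (y ∷ [])
  ... | yes ()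
  ... | no _ = refl

  sing-diff : (x y : Letter k) → ¬ x ≡ y → (v : Word k) → sing y (x ∷ v) ≡ 0
  sing-diff x y x≢y v with Listₚ.≡-dec _≟L_ (x ∷ v) (y ∷ [])
  ... | yes refl = ⊥-elim (x≢y refl)
  ... | no _ = refl

  sing⊗-same : (y : Letter k) (t : Series k) (u : Word k) → (sing y ⊗ t) (y ∷ u) ≡ t u
  sing⊗-same y t u = trans (⊗-∷ (sing y) t y u) (trans (⊗-congˡ (∂ y (sing y)) 𝟙 t (sing-same y) u) (𝟙⊗ t u))

  sing⊗-diff : (x y : Letter k) → ¬ x ≡ y → (t : Series k) (u : Word k) → (sing y ⊗ t) (x ∷ u) ≡ 0
  sing⊗-diff x y x≢y t u = trans (⊗-∷ (sing y) t x u) (trans (⊗-congˡ (∂ x (sing y)) 𝟘 t (sing-diff x y x≢y) u) (𝟘⊗ t u))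

  VanishesBelow : Series k → ℕ → Set
  VanishesBelow s p = ∀ w → length w < p → s w ≡ 0

  ⊗-vanishes : (s t : Series k) (p q : ℕ) → VanishesBelow s p → VanishesBelow t q → VanishesBelow (s ⊗ t) (p + q)
  ⊗-vanishes s t zero q vs vt [] lt = trans (⊗-[] s t) (trans (cong (s [] *_) (vt [] lt)) (ℕₚ.*-zeroʳ (s [])))
  ⊗-vanishes s t (suc p) q vs vt [] lt = trans (⊗-[] s t) (cong (_* t []) (vs [] (s≤s z≤n)))
  ⊗-vanishes s t zero q vs vt (x ∷ w) lt = trans (⊗-∷ s t x w)
     (cong₂ _+_ (trans (cong (s [] *_) (vt (x ∷ w) lt)) (ℕₚ.*-zeroʳ (s [])))
                (⊗-vanishes (∂ x s) t zero q (λ _ ()) vt w (ℕₚ.<-trans (ℕₚ.n<1+n _) lt)))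
  ⊗-vanishes s t (suc p) q vs vt (x ∷ w) (s≤s lt) = trans (⊗-∷ s t x w)
     (cong₂ _+_ (cong (_* t (x ∷ w)) (vs [] (s≤s z≤n)))
                (⊗-vanishes (∂ x s) t p q (λ w' l → vs (x ∷ w') (s≤s l)) vt w lt))

  ^-vanishes : (W : Series k) → W [] ≡ 0 → (m : ℕ) → VanishesBelow (W ^ m) m
  ^-vanishes W W₀ zero w ()
  ^-vanishes W W₀ (suc m) = ⊗-vanishes W (W ^ m) 1 m W-vanishes (^-vanishes W W₀ m)
    where
    W-vanishes : VanishesBelow W 1
    W-vanishes [] _ = W₀
    W-vanishes (_ ∷ _) (s≤s ())

  sumBelow : (ℕ → ℕ) → ℕ → ℕ
  sumBelow g n = sum (applyUpTo g n)

  sumBelow-cong : (f g : ℕ → ℕ) → (∀ m → f m ≡ g m) → ∀ n → sumBelow f n ≡ sumBelow g n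
  sumBelow-cong f g e zero = refl
  sumBelow-cong f g e (suc n) = cong₂ _+_ (e 0) (sumBelow-cong (f ∘ suc) (g ∘ suc) (e ∘ suc) n)

  sumBelow-extend : (g : ℕ → ℕ) (n n' : ℕ) → n ≤ n' → (∀ m → n ≤ m → g m ≡ 0) → sumBelow g n ≡ sumBelow g n'
  sumBelow-extend g zero n' _ e = sym (trans (sumBelow-cong g (λ _ → 0) (λ m → e m z≤n) n') (zeros n'))
    where
    zeros : ∀ n → sumBelow (λ _ → 0) n ≡ 0
    zeros zero = refl
    zeros (suc n) = zeros n
  sumBelow-extend g (suc n) (suc n') (s≤s le) e =
    cong (g 0 +_) (sumBelow-extend (g ∘ suc) n n' le (λ m l → e (suc m) (s≤s l)))

  ⊗-sumBelow : (s : Series k) (f : ℕ → Series k) (n : ℕ) (u : Word k) →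
               (s ⊗ (λ v → sumBelow (λ m → f m v) n)) u ≡ sumBelow (λ m → (s ⊗ f m) u) n
  ⊗-sumBelow s f zero u = ⊗𝟘 s u
  ⊗-sumBelow s f (suc n) u = trans (⊗-⊕ s (f 0) (λ v → sumBelow (λ m → f (suc m) v) n) u)
                                   (cong ((s ⊗ f 0) u +_) (⊗-sumBelow s (f ∘ suc) n u))

  inv1-≡sumBelow : (W : Series k) (u : Word k) → inv1- W u ≡ sumBelow (λ m → (W ^ m) u) (suc (length u))
  inv1-≡sumBelow W u = cong sum (Listₚ.map-applyUpTo (λ m → m) (λ m → (W ^ m) u) (suc (length u)))

  inv1-∷ : (W : Series k) → W [] ≡ 0 → (x : Letter k) (v : Word k) → inv1- W (x ∷ v) ≡ (∂ x W ⊗ inv1- W) v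
  inv1-∷ W W₀ x v = begin
      inv1- W (x ∷ v)
    ≡⟨ inv1-≡sumBelow W (x ∷ v) ⟩
      sumBelow (λ m → (W ^ suc m) (x ∷ v)) n
    ≡⟨ sumBelow-cong _ _ (λ m → trans (⊗-∷ W (W ^ m) x v)
                                       (cong (λ z → z * (W ^ m) (x ∷ v) + (∂ x W ⊗ (W ^ m)) v) W₀)) n ⟩
      sumBelow (λ m → (∂ x W ⊗ (W ^ m)) v) n
    ≡⟨ sym (⊗-sumBelow (∂ x W) (W ^_) n v) ⟩
      (∂ x W ⊗ truncated) v
    ≡⟨ ⊗-congʳ (∂ x W) truncated (inv1- W) v truncated≡inv1- ⟩
      (∂ x W ⊗ inv1- W) v ∎
    where
    n : ℕ
    n = suc (length v)
    truncated : Series k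
    truncated w = sumBelow (λ m → (W ^ m) w) n
    -- on words of length ≤ |v| the terms m > |v| of the star vanish
    truncated≡inv1- : ∀ w → length w ≤ length v → truncated w ≡ inv1- W w
    truncated≡inv1- w le = sym (trans (inv1-≡sumBelow W w)
      (sumBelow-extend (λ m → (W ^ m) w) (suc (length w)) n (s≤s le) (λ m l → ^-vanishes W W₀ m w l)))

  Σfin : {n : ℕ} → (Fin n → Series k) → Series k
  Σfin F v = sum (tabulate (λ ℓ → F ℓ v))

  Σℓ≈Σfin : (F : Fin k → Series k) → Σℓ F ≈ Σfin F
  Σℓ≈Σfin F v = cong sum (Listₚ.map-tabulate (λ ℓ → ℓ) (λ ℓ → F ℓ v))

  Σfin-⊗ : {n : ℕ} (F : Fin n → Series k) (t : Series k) → (Σfin F ⊗ t) ≈ Σfin (λ ℓ → F ℓ ⊗ t)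
  Σfin-⊗ {zero} F t u = 𝟘⊗ t u
  Σfin-⊗ {suc n} F t u = trans (⊕-⊗ (F fzero) (Σfin (F ∘ fsuc)) t u)
                               (cong ((F fzero ⊗ t) u +_) (Σfin-⊗ (F ∘ fsuc) t u))

sumFin-zero : {n : ℕ} (h : Fin n → ℕ) → (∀ ℓ → h ℓ ≡ 0) → sum (tabulate h) ≡ 0
sumFin-zero {zero} h e = refl
sumFin-zero {suc n} h e = cong₂ _+_ (e fzero) (sumFin-zero (h ∘ fsuc) (e ∘ fsuc))

sumFin-single : {n : ℕ} (h : Fin n → ℕ) (ℓ₀ : Fin n) → (∀ ℓ → ¬ ℓ ≡ ℓ₀ → h ℓ ≡ 0) → sum (tabulate h) ≡ h ℓ₀
sumFin-single {suc n} h fzero e =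
  trans (cong (h fzero +_) (sumFin-zero (h ∘ fsuc) (λ ℓ → e (fsuc ℓ) (λ ())))) (ℕₚ.+-identityʳ _)
sumFin-single {suc n} h (fsuc ℓ₀) e =
  trans (cong (_+ sum (tabulate (h ∘ fsuc))) (e fzero (λ ())))
        (sumFin-single (h ∘ fsuc) ℓ₀ (λ ℓ ℓ≢ → e (fsuc ℓ) (ℓ≢ ∘ suc-injective)))

-- An optional absolute ceiling for the heights of a path.
Ceiling : Set
Ceiling = Maybe ℕ

Under : Ceiling → ℕ → Set
Under nothing  _ = ⊤
Under (just t) z = z ≤ t

under? : (T : Ceiling) (z : ℕ) → Dec (Under T z)
under? nothing  z = yes tt
under? (just t) z = z ℕₚ.≤? t

under-mono : (T : Ceiling) {y y' : ℕ} → y ≤ y' → Under T y' → Under T y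
under-mono nothing  _  _ = tt
under-mono (just t) le h = ℕₚ.≤-trans le h

guard : {A : Set} → Dec A → Maybe ℕ → Maybe ℕ
guard (yes _) r = r
guard (no _)  _ = nothing

guard-yes : {A : Set} → A → (d : Dec A) (r : Maybe ℕ) → guard d r ≡ r
guard-yes _ (yes _) r = refl
guard-yes p (no ¬p) r = ⊥-elim (¬p p)

guard-no : {A : Set} → ¬ A → (d : Dec A) (r : Maybe ℕ) → guard d r ≡ nothing
guard-no ¬p (yes p) r = ⊥-elim (¬p p)
guard-no _  (no _)  r = refl

guard-nothing : {A : Set} (d : Dec A) → guard d nothing ≡ nothing
guard-nothing (yes _) = refl
guard-nothing (no _)  = refl

guard-just : {A : Set} (d : Dec A) (r : Maybe ℕ) {y : ℕ} → guard d r ≡ just y → A × r ≡ just y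
guard-just (yes p) r e = p , e
guard-just (no _)  r ()

indicator : {A : Set} → Dec A → ℕ
indicator (yes _) = 1
indicator (no _)  = 0

indicator-yes : {A : Set} → A → (d : Dec A) → indicator d ≡ 1
indicator-yes _ (yes _) = refl
indicator-yes p (no ¬p) = ⊥-elim (¬p p)

indicator-no : {A : Set} → ¬ A → (d : Dec A) → indicator d ≡ 0
indicator-no ¬p (yes p) = ⊥-elim (¬p p)
indicator-no _  (no _)  = refl

rise : {k : ℕ} → Fin k → ℕ
rise ℓ = suc (toℕ ℓ)

move : {k : ℕ} → ℕ → Ceiling → ℕ → Letter k → Maybe ℕ
move i T y (a z ℓ) = guard (z ℕₚ.≟ y) (guard (under? T (y + rise ℓ)) (just (y + rise ℓ)))
move i T y (b z)   = guard (z ℕₚ.≟ y) (guard (i ℕₚ.<? y) (just (y ∸ 1)))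
move i T y (c z)   = guard (z ℕₚ.≟ y) (just y)

mutual
  paths : {k : ℕ} → ℕ → Ceiling → ℕ → Series k
  paths i T y []      = indicator (y ℕₚ.≟ i)
  paths i T y (x ∷ u) = pathsFrom i T (move i T y x) u

  pathsFrom : {k : ℕ} → ℕ → Ceiling → Maybe ℕ → Series k
  pathsFrom i T nothing  u = 0
  pathsFrom i T (just y) u = paths i T y u

move-above : {k i y y' : ℕ} {T : Ceiling} (x : Letter k) → i ≤ y → move i T y x ≡ just y' → i ≤ y'
move-above {y = y} {T = T} (a z ℓ) i≤y e
  with refl ← proj₂ (guard-just (under? T (y + rise ℓ)) _ (proj₂ (guard-just (z ℕₚ.≟ y) _ e)))
  = ℕₚ.≤-trans i≤y (ℕₚ.m≤m+n y (rise ℓ))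
move-above {i = i} {y = y} (b z) i≤y e
  with i<y , refl ← guard-just (i ℕₚ.<? y) (just (y ∸ 1)) (proj₂ (guard-just (z ℕₚ.≟ y) _ e))
  = below-pred i<y
  where
  below-pred : {i y : ℕ} → i < y → i ≤ y ∸ 1
  below-pred (s≤s i≤y) = i≤y
move-above {y = y} (c z) i≤y e
  with refl ← proj₂ (guard-just (z ℕₚ.≟ y) _ e)
  = i≤y

move-floor : {k i i' y : ℕ} {T : Ceiling} (x : Letter k) → i < y → i' < y → move i T y x ≡ move i' T y x
move-floor (a z ℓ) _ _ = refl
move-floor {i = i} {i'} {y} (b z) i<y i'<y =
  cong (guard (z ℕₚ.≟ y)) (trans (guard-yes i<y (i ℕₚ.<? y) _) (sym (guard-yes i'<y (i' ℕₚ.<? y) _)))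
move-floor (c z) _ _ = refl

-- First-passage decomposition: a path from height y ≥ j+1 down to level i ≤ j
-- factors uniquely at its first step from level j+1 to level j.
module FirstPassage {k : ℕ} (T : Ceiling) where
  open SeriesAlgebra {k}

  -- the part of the path after that first descent: b_{j+1} · paths(i, j)
  descent : ℕ → ℕ → Series k
  descent i j = sing (b (suc j)) ⊗ paths i T j

  first-passage : (u : Word k) (i j y : ℕ) → i ≤ j → suc j ≤ y →
                  (paths (suc j) T y ⊗ descent i j) u ≡ paths i T y u

  -- the factorisation after reading the letter x, according to whether the
  -- path is currently at level j+1 (it may then descend) or strictly above
  first-passage-∷ : (x : Letter k) (u : Word k) (i j y : ℕ) → i ≤ j → suc j ≤ y → (d : Dec (y ≡ suc j)) →
    indicator d * descent i j (x ∷ u) + (pathsFrom (suc j) T (move (suc j) T y x) ⊗ descent i j) u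
      ≡ pathsFrom i T (move i T y x) u

  continue : (u : Word k) (i j : ℕ) → i ≤ j → (r : Maybe ℕ) → (∀ {y'} → r ≡ just y' → suc j ≤ y') →
             (pathsFrom (suc j) T r ⊗ descent i j) u ≡ pathsFrom i T r u
  continue u i j i≤j nothing  _     = 𝟘⊗ (descent i j) u
  continue u i j i≤j (just y) above = first-passage u i j y i≤j (above refl)

  first-passage [] i j y i≤j j<y =
    trans (⊗-[] (paths (suc j) T y) (descent i j))
          (trans (ℕₚ.*-zeroʳ (paths {k} (suc j) T y [])) (sym (indicator-no y≢i (y ℕₚ.≟ i))))
    where
    y≢i : ¬ y ≡ i
    y≢i refl = ℕₚ.<-irrefl refl (ℕₚ.≤-<-trans i≤j j<y)
  first-passage (x ∷ u) i j y i≤j j<y =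
    trans (⊗-∷ (paths (suc j) T y) (descent i j) x u) (first-passage-∷ x u i j y i≤j j<y (y ℕₚ.≟ suc j))

  -- strictly above level j+1 nothing can happen yet
  first-passage-∷ x u i j y i≤j j<y (no y≢) =
    trans (continue u i j i≤j (move (suc j) T y x) (move-above x j<y))
          (cong (λ r → pathsFrom i T r u) (move-floor x j+1<y (ℕₚ.≤-<-trans i≤j j<y)))
    where
    j+1<y : suc j < y
    j+1<y = ℕₚ.≤∧≢⇒< j<y (y≢ ∘ sym)
  -- at level j+1, a step b_{j+1} is the first descent; other steps continue
  first-passage-∷ (b z) u i j _ i≤j _ (yes refl) = begin
      1 * descent i j (b z ∷ u) + (pathsFrom (suc j) T (move {k} (suc j) T (suc j) (b z)) ⊗ descent i j) u
    ≡⟨ cong₂ _+_ (ℕₚ.*-identityˡ _)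
                 (trans (cong (λ r → (pathsFrom (suc j) T r ⊗ descent i j) u) no-descent-below-floor)
                        (𝟘⊗ (descent i j) u)) ⟩
      descent i j (b z ∷ u) + 0
    ≡⟨ ℕₚ.+-identityʳ _ ⟩
      descent i j (b z ∷ u)
    ≡⟨ first-descent (z ℕₚ.≟ suc j) ⟩
      pathsFrom i T (move {k} i T (suc j) (b z)) u ∎
    where
    open ≡-Reasoning
    no-descent-below-floor : move {k} (suc j) T (suc j) (b z) ≡ nothing
    no-descent-below-floor = trans (cong (guard (z ℕₚ.≟ suc j)) (guard-no (ℕₚ.<-irrefl refl) (suc j ℕₚ.<? suc j) _))
                                   (guard-nothing (z ℕₚ.≟ suc j))
    first-descent : (d : Dec (z ≡ suc j)) → descent i j (b z ∷ u) ≡ pathsFrom i T (guard d (guard (i ℕₚ.<? suc j) (just j))) u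
    first-descent (yes refl) = trans (sing⊗-same (b (suc j)) (paths i T j) u)
                                     (cong (λ r → pathsFrom i T r u) (sym (guard-yes (s≤s i≤j) (i ℕₚ.<? suc j) _)))
    first-descent (no z≢) = sing⊗-diff (b z) (b (suc j)) (λ { refl → z≢ refl }) (paths i T j) u
  first-passage-∷ (a z ℓ) u i j _ i≤j _ (yes refl) =
    trans (cong₂ _+_ (cong (1 *_) (sing⊗-diff (a z ℓ) (b (suc j)) (λ ()) (paths i T j) u)) refl)
          (continue u i j i≤j (move {k} (suc j) T (suc j) (a z ℓ)) (move-above (a z ℓ) ℕₚ.≤-refl))
  first-passage-∷ (c z) u i j _ i≤j _ (yes refl) =
    trans (cong₂ _+_ (cong (1 *_) (sing⊗-diff (c z) (b (suc j)) (λ ()) (paths i T j) u)) refl)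
          (continue u i j i≤j (move {k} (suc j) T (suc j) (c z)) (move-above {k} {T = T} (c z) ℕₚ.≤-refl))

LevelFamily : {k : ℕ} → ℕ → Ceiling → (ℕ → Series k) → Set
LevelFamily i T G = ∀ m → (Under T (i + m) → G m ≈ paths (i + m) T (i + m))
                        × (¬ Under T (i + m) → G m ≈ 𝟘)

module Recursion {k : ℕ} (i : ℕ) (T : Ceiling) (G : ℕ → Series k) (HG : LevelFamily i T G) where
  open SeriesAlgebra {k}
  open FirstPassage {k} T
  open ≡-Reasoning

  W : Series k
  W = sing (c i) ⊕ Σℓ (bracket i G)

  W-[] : W [] ≡ 0
  W-[] = trans (Σℓ≈Σfin (bracket i G) [])
               (sumFin-zero _ (λ ℓ → ⊗-[] (sing (a i ℓ)) (chain i G (rise ℓ))))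

  AgreesUpTo : Word k → Set
  AgreesUpTo w = ∀ w' → length w' ≤ length w → rhs i G w' ≡ paths i T i w'

  -- A chain G j b_{i+j} ⋯ G 1 b_{i+1} followed by a path back at level i is a
  -- path from level i+j down to level i (first-passage decomposition).
  chain-under : (j : ℕ) (w : Word k) → AgreesUpTo w → Under T (i + j) →
                (chain i G j ⊗ rhs i G) w ≡ paths i T (i + j) w
  chain-under zero w ih _ =
    trans (𝟙⊗ (rhs i G) w) (trans (ih w ℕₚ.≤-refl) (cong (λ y → paths i T y w) (sym (ℕₚ.+-identityʳ i))))
  chain-under (suc j) w ih under = begin
      (((G (suc j) ⊗ sb) ⊗ chain i G j) ⊗ rhs i G) w
    ≡⟨ trans (⊗-assoc (G (suc j) ⊗ sb) (chain i G j) (rhs i G) w)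
             (⊗-assoc (G (suc j)) sb (chain i G j ⊗ rhs i G) w) ⟩
      (G (suc j) ⊗ (sb ⊗ (chain i G j ⊗ rhs i G))) w
    ≡⟨ ⊗-congʳ (G (suc j)) _ (sb ⊗ paths i T (i + j)) w (λ w' l →
         ⊗-congʳ sb _ _ w' (λ w'' l' →
           chain-under j w'' (λ w₃ l₃ → ih w₃ (ℕₚ.≤-trans l₃ (ℕₚ.≤-trans l' l)))
                             (under-mono T (ℕₚ.+-monoʳ-≤ i (ℕₚ.n≤1+n j)) under))) ⟩
      (G (suc j) ⊗ (sb ⊗ paths i T (i + j))) w
    ≡⟨ ⊗-congˡ (G (suc j)) _ (sb ⊗ paths i T (i + j)) (proj₁ (HG (suc j)) under) w ⟩
      (paths (i + suc j) T (i + suc j) ⊗ (sing (b (i + suc j)) ⊗ paths i T (i + j))) w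
    ≡⟨ cong (λ n → (paths n T n ⊗ (sing (b n) ⊗ paths i T (i + j))) w) (ℕₚ.+-suc i j) ⟩
      (paths (suc (i + j)) T (suc (i + j)) ⊗ descent i (i + j)) w
    ≡⟨ first-passage w i (i + j) (suc (i + j)) (ℕₚ.m≤m+n i j) ℕₚ.≤-refl ⟩
      paths i T (suc (i + j)) w
    ≡⟨ cong (λ n → paths i T n w) (sym (ℕₚ.+-suc i j)) ⟩
      paths i T (i + suc j) w ∎
    where
    sb : Series k
    sb = sing (b (i + suc j))

  chain-above : (j : ℕ) (w : Word k) → ¬ Under T (i + suc j) → (chain i G (suc j) ⊗ rhs i G) w ≡ 0
  chain-above j w over = begin
      (((G (suc j) ⊗ sb) ⊗ chain i G j) ⊗ rhs i G) w
    ≡⟨ trans (⊗-assoc (G (suc j) ⊗ sb) (chain i G j) (rhs i G) w)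
             (⊗-assoc (G (suc j)) sb (chain i G j ⊗ rhs i G) w) ⟩
      (G (suc j) ⊗ (sb ⊗ (chain i G j ⊗ rhs i G))) w
    ≡⟨ ⊗-congˡ (G (suc j)) 𝟘 _ (proj₂ (HG (suc j)) over) w ⟩
      (𝟘 ⊗ (sb ⊗ (chain i G j ⊗ rhs i G))) w
    ≡⟨ 𝟘⊗ (sb ⊗ (chain i G j ⊗ rhs i G)) w ⟩
      0 ∎
    where
    sb : Series k
    sb = sing (b (i + suc j))

  bracketTerm : Letter k → Word k → Fin k → ℕ
  bracketTerm x v ℓ = (sing (a i ℓ) ⊗ (chain i G (rise ℓ) ⊗ rhs i G)) (x ∷ v)

  quotient-split : (x : Letter k) (v : Word k) →
    (∂ x W ⊗ rhs i G) v ≡ (sing (c i) ⊗ rhs i G) (x ∷ v) + sum (tabulate (bracketTerm x v))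
  quotient-split x v = begin
      (∂ x W ⊗ rhs i G) v
    ≡⟨ ⊕-⊗ (∂ x (sing (c i))) (∂ x (Σℓ (bracket i G))) (rhs i G) v ⟩
      (∂ x (sing (c i)) ⊗ rhs i G) v + (∂ x (Σℓ (bracket i G)) ⊗ rhs i G) v
    ≡⟨ cong₂ _+_ (sym (⊗-∷ (sing (c i)) (rhs i G) x v))
                 (⊗-congˡ _ (Σfin (∂ x ∘ bracket i G)) (rhs i G) (Σℓ≈Σfin (∂ x ∘ bracket i G)) v) ⟩
      (sing (c i) ⊗ rhs i G) (x ∷ v) + (Σfin (∂ x ∘ bracket i G) ⊗ rhs i G) v
    ≡⟨ cong ((sing (c i) ⊗ rhs i G) (x ∷ v) +_)
            (trans (Σfin-⊗ (∂ x ∘ bracket i G) (rhs i G) v) (cong sum (Listₚ.tabulate-cong bracket-quotient))) ⟩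
      (sing (c i) ⊗ rhs i G) (x ∷ v) + sum (tabulate (bracketTerm x v)) ∎
    where
    bracket-quotient : (ℓ : Fin k) → (∂ x (bracket i G ℓ) ⊗ rhs i G) v ≡ bracketTerm x v ℓ
    bracket-quotient ℓ = begin
        (∂ x (bracket i G ℓ) ⊗ rhs i G) v
      ≡⟨ ⊗-congˡ _ (∂ x (sing (a i ℓ)) ⊗ chain i G (rise ℓ)) (rhs i G) (⊗-∷ (sing (a i ℓ)) (chain i G (rise ℓ)) x) v ⟩
        ((∂ x (sing (a i ℓ)) ⊗ chain i G (rise ℓ)) ⊗ rhs i G) v
      ≡⟨ ⊗-assoc (∂ x (sing (a i ℓ))) (chain i G (rise ℓ)) (rhs i G) v ⟩
        (∂ x (sing (a i ℓ)) ⊗ (chain i G (rise ℓ) ⊗ rhs i G)) v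
      ≡⟨ sym (⊗-∷ (sing (a i ℓ)) (chain i G (rise ℓ) ⊗ rhs i G) x v) ⟩
        bracketTerm x v ℓ ∎

  bracketTerms-vanish : (x : Letter k) (v : Word k) → (∀ ℓ → ¬ x ≡ a i ℓ) → sum (tabulate (bracketTerm x v)) ≡ 0
  bracketTerms-vanish x v x≢ = sumFin-zero (bracketTerm x v) (λ ℓ → sing⊗-diff x (a i ℓ) (x≢ ℓ) _ v)

  bracketTerms-single : (ℓ₀ : Fin k) (v : Word k) →
    sum (tabulate (bracketTerm (a i ℓ₀) v)) ≡ (chain i G (rise ℓ₀) ⊗ rhs i G) v
  bracketTerms-single ℓ₀ v =
    trans (sumFin-single (bracketTerm (a i ℓ₀) v) ℓ₀
                         (λ ℓ ℓ≢ → sing⊗-diff (a i ℓ₀) (a i ℓ) (λ { refl → ℓ≢ refl }) _ v))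
          (sing⊗-same (a i ℓ₀) _ v)

  after-up-step : (ℓ : Fin k) (v : Word k) → AgreesUpTo v → (d : Dec (Under T (i + rise ℓ))) →
    (chain i G (rise ℓ) ⊗ rhs i G) v ≡ pathsFrom i T (guard d (just (i + rise ℓ))) v
  after-up-step ℓ v ih (yes under) = chain-under (rise ℓ) v ih under
  after-up-step ℓ v ih (no over)   = chain-above (toℕ ℓ) v over

  rhs≡paths : (n : ℕ) (u : Word k) → length u ≤ n → rhs i G u ≡ paths i T i u
  rhs≡paths n [] _ = sym (indicator-yes refl (i ℕₚ.≟ i))
  rhs≡paths (suc n) (x ∷ v) (s≤s |v|≤n) =
    trans (inv1-∷ W W-[] x v) (trans (quotient-split x v) (first-letter x))
    where
    ih : AgreesUpTo v
    ih w l = rhs≡paths n w (ℕₚ.≤-trans l |v|≤n)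

    first-letter : (x : Letter k) →
      (sing (c i) ⊗ rhs i G) (x ∷ v) + sum (tabulate (bracketTerm x v)) ≡ paths i T i (x ∷ v)
    first-letter (c z) with z ℕₚ.≟ i
    ... | yes refl = trans (cong₂ _+_ (sing⊗-same (c i) (rhs i G) v) (bracketTerms-vanish (c i) v (λ _ ())))
                           (trans (ℕₚ.+-identityʳ _) (ih v ℕₚ.≤-refl))
    ... | no z≢i   = cong₂ _+_ (sing⊗-diff (c z) (c i) (λ { refl → z≢i refl }) (rhs i G) v)
                               (bracketTerms-vanish (c z) v (λ _ ()))
    first-letter (b z) = begin
        (sing (c i) ⊗ rhs i G) (b z ∷ v) + sum (tabulate (bracketTerm (b z) v))
      ≡⟨ cong₂ _+_ (sing⊗-diff (b z) (c i) (λ ()) (rhs i G) v) (bracketTerms-vanish (b z) v (λ _ ())) ⟩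
        0
      ≡⟨ cong (λ r → pathsFrom i T r v) (sym no-step-below-floor) ⟩
        paths i T i (b z ∷ v) ∎
      where
      no-step-below-floor : move {k} i T i (b z) ≡ nothing
      no-step-below-floor = trans (cong (guard (z ℕₚ.≟ i)) (guard-no (ℕₚ.<-irrefl refl) (i ℕₚ.<? i) _))
                                  (guard-nothing (z ℕₚ.≟ i))
    first-letter (a z ℓ₀) with z ℕₚ.≟ i
    ... | yes refl = trans (cong₂ _+_ (sing⊗-diff (a i ℓ₀) (c i) (λ ()) (rhs i G) v) (bracketTerms-single ℓ₀ v))
                           (after-up-step ℓ₀ v ih (under? T (i + rise ℓ₀)))
    ... | no z≢i   = cong₂ _+_ (sing⊗-diff (a z ℓ₀) (c i) (λ ()) (rhs i G) v)
                               (bracketTerms-vanish (a z ℓ₀) v (λ { ℓ refl → z≢i refl }))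

-- The paths series are the characteristic series of the sets PathSet, whose
-- relative bound h becomes the absolute ceiling i + h.
ceiling : ℕ → Maybe ℕ → Ceiling
ceiling i = maybe-map (i +_)

under-ceiling : (B : Maybe ℕ) {i : ℕ} (z : ℕ) → BelowTop B i z → Under (ceiling i B) z
under-ceiling (just _) z h = h
under-ceiling nothing  z _ = tt

below-top : (B : Maybe ℕ) {i : ℕ} (z : ℕ) → Under (ceiling i B) z → BelowTop B i z
below-top (just _) z h = h
below-top nothing  z _ = tt

module Characterisation {k : ℕ} (i : ℕ) (B : Maybe ℕ) where
  T : Ceiling
  T = ceiling i B

  PathFrom : ℕ → Word k → Set
  PathFrom y u = Σ (List (Step k)) λ p → label y p ≡ u × Stays i B y p

  paths-sound : (p : List (Step k)) (y : ℕ) → Stays i B y p → paths i T y (label y p) ≡ 1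
  paths-sound [] y st = indicator-yes st (y ℕₚ.≟ i)
  paths-sound (up ℓ ∷ p) y (top , st) =
    trans (cong (λ r → pathsFrom i T r (label (y + rise ℓ) p))
                (trans (guard-yes refl (y ℕₚ.≟ y) _) (guard-yes (under-ceiling B (y + rise ℓ) top) (under? T (y + rise ℓ)) _)))
          (paths-sound p (y + rise ℓ) st)
  paths-sound (down ∷ p) y (i<y , st) =
    trans (cong (λ r → pathsFrom i T r (label (y ∸ 1) p))
                (trans (guard-yes refl (y ℕₚ.≟ y) _) (guard-yes i<y (i ℕₚ.<? y) _)))
          (paths-sound p (y ∸ 1) st)
  paths-sound (flat ∷ p) y st =
    trans (cong (λ r → pathsFrom i T r (label y p)) (guard-yes refl (y ℕₚ.≟ y) _)) (paths-sound p y st)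

  extend-up : {u : Word k} {y y' : ℕ} (ℓ : Fin k) → guard (under? T (y + rise ℓ)) (just (y + rise ℓ)) ≡ just y' →
              PathFrom y' u → PathFrom y (a y ℓ ∷ u)
  extend-up {y = y} ℓ e (p , l , st) with top , refl ← guard-just (under? T (y + rise ℓ)) (just (y + rise ℓ)) e =
    up ℓ ∷ p , cong (a y ℓ ∷_) l , below-top B (y + rise ℓ) top , st

  extend-down : {u : Word k} {y y' : ℕ} → guard (i ℕₚ.<? y) (just (y ∸ 1)) ≡ just y' →
                PathFrom y' u → PathFrom y (b y ∷ u)
  extend-down {y = y} e (p , l , st) with i<y , refl ← guard-just (i ℕₚ.<? y) (just (y ∸ 1)) e =
    down ∷ p , cong (b y ∷_) l , i<y , st

  extend : (x : Letter k) {u : Word k} {y y' : ℕ} → move i T y x ≡ just y' → PathFrom y' u → PathFrom y (x ∷ u)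
  extend (a z ℓ) {y = y} e ps with refl , e' ← guard-just (z ℕₚ.≟ y) _ e = extend-up ℓ e' ps
  extend (b z)   {y = y} e ps with refl , e' ← guard-just (z ℕₚ.≟ y) _ e = extend-down e' ps
  extend (c z)   {y = y} e (p , l , st) with refl , refl ← guard-just (z ℕₚ.≟ y) (just y) e =
    flat ∷ p , cong (c y ∷_) l , st

  paths-complete : (u : Word k) (y : ℕ) → paths i T y u ≡ 0 ⊎ PathFrom y u
  paths-complete [] y with y ℕₚ.≟ i
  ... | yes y≡i = inj₂ ([] , refl , y≡i)
  ... | no _    = inj₁ refl
  paths-complete (x ∷ u) y = after (move i T y x) refl
    where
    after : (r : Maybe ℕ) → move i T y x ≡ r → pathsFrom i T r u ≡ 0 ⊎ PathFrom y (x ∷ u)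
    after nothing   _ = inj₁ refl
    after (just y') e with paths-complete u y'
    ... | inj₁ zero-coeff = inj₁ zero-coeff
    ... | inj₂ path       = inj₂ (extend x e path)

  char-series≡paths : (s : Series k) → IsCharSeries (PathSet k i B) s → s ≈ paths i T i
  char-series≡paths s char u with paths-complete u i
  ... | inj₁ zero-coeff = trans (proj₂ (char u) no-path) (sym zero-coeff)
    where
    no-path : ¬ PathSet k i B u
    no-path (p , refl , st) with () ← trans (sym (paths-sound p i st)) zero-coeff
  ... | inj₂ (p , refl , st) = trans (proj₁ (char u) (p , refl , st)) (sym (paths-sound p i st))

-- A ceiling t ≥ y + |u|·k cannot be reached when reading u from height y, so
-- it does not change the coefficient of u.
module HeightBound {k : ℕ} (i : ℕ) where
  move-rise : {T : Ceiling} {y y' : ℕ} (x : Letter k) → move i T y x ≡ just y' → y' ≤ y + k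
  move-rise {T} {y} (a z ℓ) e with refl ← proj₂ (guard-just (under? T (y + rise ℓ)) _ (proj₂ (guard-just (z ℕₚ.≟ y) _ e))) =
    ℕₚ.+-monoʳ-≤ y (toℕ<n ℓ)
  move-rise {y = y} (b z) e with refl ← proj₂ (guard-just (i ℕₚ.<? y) (just (y ∸ 1)) (proj₂ (guard-just (z ℕₚ.≟ y) _ e))) =
    ℕₚ.≤-trans (ℕₚ.m∸n≤m y 1) (ℕₚ.m≤m+n y k)
  move-rise {y = y} (c z) e with refl ← proj₂ (guard-just (z ℕₚ.≟ y) (just y) e) = ℕₚ.m≤m+n y k

  move-ceiling-irrelevant : {t y : ℕ} (x : Letter k) → y + k ≤ t → move i (just t) y x ≡ move i nothing y x
  move-ceiling-irrelevant {t} {y} (a z ℓ) y+k≤t =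
    cong (guard (z ℕₚ.≟ y)) (guard-yes (ℕₚ.≤-trans (ℕₚ.+-monoʳ-≤ y (toℕ<n ℓ)) y+k≤t) (y + rise ℓ ℕₚ.≤? t) _)
  move-ceiling-irrelevant (b z) _ = refl
  move-ceiling-irrelevant (c z) _ = refl

  paths-ceiling-irrelevant : (u : Word k) (y t : ℕ) → y + length u * k ≤ t → paths i (just t) y u ≡ paths i nothing y u
  paths-ceiling-irrelevant [] y t _ = refl
  paths-ceiling-irrelevant (x ∷ u) y t bound =
    trans (cong (λ r → pathsFrom i (just t) r u) (move-ceiling-irrelevant x (ℕₚ.≤-trans (ℕₚ.m≤m+n (y + k) _) bound′)))
          (rest (move i nothing y x) (move-rise x))
    where
    bound′ : y + k + length u * k ≤ t
    bound′ = ℕₚ.≤-trans (ℕₚ.≤-reflexive (ℕₚ.+-assoc y k (length u * k))) bound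
    rest : (r : Maybe ℕ) → (∀ {y'} → r ≡ just y' → y' ≤ y + k) → pathsFrom i (just t) r u ≡ pathsFrom i nothing r u
    rest nothing   _     = refl
    rest (just y') risen =
      paths-ceiling-irrelevant u y' t (ℕₚ.≤-trans (ℕₚ.+-monoˡ-≤ (length u * k) (risen refl)) bound′)

finG-levelFamily : {k : ℕ} (C : ℕ → ℕ → Series k) → (∀ i h → C i h ≈ paths i (just (i + h)) i) →
                   (i h : ℕ) → LevelFamily i (just (i + h)) (finG C i h)
finG-levelFamily C C≈paths i h m with m ≤ᵇ h | ℕₚ.≤ᵇ-reflects-≤ m h
... | true  | ofʸ m≤h = (λ _ v → trans (C≈paths (i + m) (h ∸ m) v) (cong (λ t → paths (i + m) (just t) (i + m) v) same-ceiling))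
                      , (λ over → ⊥-elim (over (ℕₚ.+-monoʳ-≤ i m≤h)))
  where
  same-ceiling : i + m + (h ∸ m) ≡ i + h
  same-ceiling = trans (ℕₚ.+-assoc i m (h ∸ m)) (cong (i +_) (ℕₚ.m+[n∸m]≡n m≤h))
... | false | ofⁿ m≰h = (λ under → ⊥-elim (m≰h (ℕₚ.+-cancelˡ-≤ i m h under))) , (λ _ _ → refl)

proposition2 : (k : ℕ) → 1 ≤ k →
    (C : ℕ → ℕ → Series k) → (∀ i h → IsCharSeries (PathSet k i (just h)) (C i h)) →
    (C∞ : ℕ → Series k) → (∀ i → IsCharSeries (PathSet k i nothing) (C∞ i)) →
    (∀ i h → C i h ≈ rhs i (finG C i h))
    × (∀ i → Converges (C i) (C∞ i))
    × (∀ i → C∞ i ≈ rhs i (λ m → C∞ (i + m)))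
proposition2 k _ C C-char C∞ C∞-char = finite-recursion , convergence , limit-recursion
  where
  C≈paths : ∀ i h → C i h ≈ paths i (just (i + h)) i
  C≈paths i h = Characterisation.char-series≡paths i (just h) (C i h) (C-char i h)

  C∞≈paths : ∀ i → C∞ i ≈ paths i nothing i
  C∞≈paths i = Characterisation.char-series≡paths i nothing (C∞ i) (C∞-char i)

  finite-recursion : ∀ i h → C i h ≈ rhs i (finG C i h)
  finite-recursion i h u = trans (C≈paths i h u)
    (sym (Recursion.rhs≡paths i (just (i + h)) (finG C i h) (finG-levelFamily C C≈paths i h) (length u) u ℕₚ.≤-refl))

  -- coefficients of words of length < N are final once h ≥ N·k
  convergence : ∀ i → Converges (C i) (C∞ i)
  convergence i N = N * k , λ h Nk≤h u |u|<N → trans (C≈paths i h u)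
    (trans (HeightBound.paths-ceiling-irrelevant i u i (i + h)
              (ℕₚ.+-monoʳ-≤ i (ℕₚ.≤-trans (ℕₚ.*-monoˡ-≤ k (ℕₚ.<⇒≤ |u|<N)) Nk≤h)))
           (sym (C∞≈paths i u)))

  limit-recursion : ∀ i → C∞ i ≈ rhs i (λ m → C∞ (i + m))
  limit-recursion i u = trans (C∞≈paths i u)
    (sym (Recursion.rhs≡paths i nothing (λ m → C∞ (i + m)) (λ m → (λ _ → C∞≈paths (i + m)) , (λ over → ⊥-elim (over tt)))
                              (length u) u ℕₚ.≤-refl))
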